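{- Suppose that for every integer $\Delta$ there exists a constant $c_\Delta$ such that every hypergraph $H$ of maximum degree at most $\Delta$ admits a strong odd coloring with at most $c_\Delta$ colors. Then there exists a function $g$ such that every graph $G$ satisfies $\chi_{\mathrm{so}}(G)\leq g(\chi^*(G))$.
   Context: All graphs and hypergraphs are finite. For a hypergraph $H=(V,E)$, a vertex-coloring (not required to be proper in any sense) is \emph{strong odd} if every hyperedge contains every color either an odd number of times or not at all; the degree of a vertex is the number of hyperedges containing it. For a graph $G$, a proper vertex-coloring $\varphi\colon V(G)\to[t]$ is \emph{strong odd} if for every vertex $v$ and color $i$ the number $|N(v)\cap\varphi^{ -1}(i)|$ is zero or odd, and $\chi_{\mathrm{so}}(G)$ is the minimum number of colors of such a coloring. The \emph{star-chromatic number} $\chi^*(G)$ is the smallest number of colors in a proper vertex-coloring of $G$ such that the union of any two color classes induces a forest of stars. -}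

module Defs where

open import Data.Nat using (ℕ; _≤_; _%_)
open import Data.Bool using (Bool; true; false; _∧_)
open import Data.Fin using (Fin; _≟_)
open import Data.Fin.Subset using (Subset; ∣_∣)
open import Data.Vec using (tabulate; lookup)
open import Data.Product using (Σ; ∃; _×_)
open import Data.Sum using (_⊎_)
open import Relation.Nullary using (¬_; does)
open import Relation.Binary.PropositionalEquality using (_≡_; _≢_)

ZeroOrOdd : ℕ → Set
ZeroOrOdd k = k ≡ 0 ⊎ k % 2 ≡ 1

record Hypergraph : Set where
  field
    nV   : ℕ
    nE   : ℕ
    edge : Fin nE → Subset nV
open Hypergraph public

hdegree : (H : Hypergraph) → Fin (nV H) → ℕ
hdegree H v = ∣ tabulate (λ j → lookup (edge H j) v) ∣

MaxDegreeAtMost : Hypergraph → ℕ → Set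
MaxDegreeAtMost H Δ = ∀ v → hdegree H v ≤ Δ

edgeColourCount : (H : Hypergraph) {c : ℕ} → (Fin (nV H) → Fin c) → Fin (nE H) → Fin c → ℕ
edgeColourCount H φ j i = ∣ tabulate (λ u → lookup (edge H j) u ∧ does (φ u ≟ i)) ∣

IsStrongOddHyp : (H : Hypergraph) {c : ℕ} → (Fin (nV H) → Fin c) → Set
IsStrongOddHyp H φ = ∀ j i → ZeroOrOdd (edgeColourCount H φ j i)

record Graph : Set where
  field
    n       : ℕ
    adj     : Fin n → Fin n → Bool
    adj-sym : ∀ u v → adj u v ≡ adj v u
    irrefl  : ∀ v → adj v v ≡ false
open Graph public

Adj : (G : Graph) → Fin (n G) → Fin (n G) → Set
Adj G u v = adj G u v ≡ true

IsProper : (G : Graph) {t : ℕ} → (Fin (n G) → Fin t) → Set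
IsProper G φ = ∀ u v → Adj G u v → φ u ≢ φ v

nbrColourCount : (G : Graph) {t : ℕ} → (Fin (n G) → Fin t) → Fin (n G) → Fin t → ℕ
nbrColourCount G φ v i = ∣ tabulate (λ u → adj G v u ∧ does (φ u ≟ i)) ∣

IsStrongOddColouring : (G : Graph) {t : ℕ} → (Fin (n G) → Fin t) → Set
IsStrongOddColouring G φ = IsProper G φ × (∀ v i → ZeroOrOdd (nbrColourCount G φ v i))

StrongOddColourable : Graph → ℕ → Set
StrongOddColourable G t = Σ (Fin (n G) → Fin t) (IsStrongOddColouring G)

-- The subgraph of G induced by the vertex set S is a forest of stars
-- (a disjoint union of stars K_{1,r}, r ≥ 0): there is an assignment of a
-- centre to each vertex of S such that each fibre {v ∈ S | centre v = c}
-- induces a star with centre c, and there are no edges between fibres.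
InducesStarForest : (G : Graph) → (Fin (n G) → Set) → Set
InducesStarForest G S =
  Σ (Fin (n G) → Fin (n G)) λ centre →
    (∀ v → S v → S (centre v) × centre (centre v) ≡ centre v)
    × (∀ v → S v → v ≢ centre v → Adj G v (centre v))
    × (∀ u v → S u → S v → Adj G u v →
         centre u ≡ centre v × (u ≡ centre u ⊎ v ≡ centre v))

IsStarColouring : (G : Graph) {t : ℕ} → (Fin (n G) → Fin t) → Set
IsStarColouring G {t} φ =
  IsProper G φ
  × (∀ (a b : Fin t) → InducesStarForest G (λ v → φ v ≡ a ⊎ φ v ≡ b))

StarColourable : Graph → ℕ → Set
StarColourable G t = Σ (Fin (n G) → Fin t) (IsStarColouring G)

IsStarChromaticNumber : Graph → ℕ → Set
IsStarChromaticNumber G s = StarColourable G s × (∀ t → StarColourable G t → s ≤ t)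

-- Fix a star colouring φ of G with s colours, and call the set N_a(v) of neighbours of v
-- of colour a crowded when it has at least two elements. If u ∈ N_a(v) is crowded, then v
-- cannot be a leaf of the star through u in the forest induced by the colours a and φ(v),
-- so v is the centre of that star: for each colour b there is at most one crowded
-- neighbourhood containing u whose owner has colour b. The crowded neighbourhoods thus form
-- a hypergraph of maximum degree at most s. If ψ is a strong odd colouring of it with c
-- colours, then u ↦ (φ(u), ψ(u)) is a strong odd colouring of G with s·c colours: a
-- neighbour class of colour (a, i) at v is either the ψ-class i of the hyperedge N_a(v), or
-- lies inside an N_a(v) with at most one element.
module Submission where

open import Defs
open import Data.Nat using (ℕ; _≤_; _*_; _≤?_; z≤n; s≤s)
open import Data.Nat.Properties using (≤-trans; ≤-reflexive; ≤-pred; ≰⇒>; n≤1⇒n≡0∨n≡1)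
open import Data.Bool using (Bool; true; T; _∧_)
open import Data.Bool.Properties using (T-≡; T-∧; ∧-assoc)
open import Data.Fin using (Fin; zero; suc; _≟_; combine; remQuot)
open import Data.Fin.Properties using (suc-injective; combine-injective; combine-injectiveˡ; remQuot-combine; combine-remQuot)
open import Data.Fin.Subset using (Subset; inside; outside; _∈_; ⊤; ⁅_⁆; _-_; ∣_∣)
open import Data.Fin.Subset.Properties using (p⊆q⇒∣p∣≤∣q∣; x∈⁅x⁆; ∣⁅x⁆∣≡1; ∈⊤; ∣⊤∣≡n; x∈p∧x≢y⇒x∈p-y; x∈p⇒∣p-x∣<∣p∣)
open import Data.Vec using ([]; _∷_; tabulate; lookup; here; there)
open import Data.Vec.Properties using (lookup∘tabulate; tabulate-cong; []=⇒lookup; lookup⇒[]=)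
open import Data.Product using (Σ; _×_; _,_; proj₁; proj₂; uncurry)
open import Data.Sum using (_⊎_; inj₁; inj₂) renaming (map₂ to ⊎-map₂)
open import Function using (_∘_; Equivalence; mk⇔)
open import Relation.Nullary using (does; yes; no; contradiction; _×-dec_)
open import Relation.Nullary.Decidable using (Dec; toWitness; isYes≗does; does-⇔)
open import Relation.Binary.PropositionalEquality

open Equivalence using (to; from)

private
  variable
    m k : ℕ

∈-tabulate⁺ : {f : Fin m → Bool} {x : Fin m} → T (f x) → x ∈ tabulate f
∈-tabulate⁺ {f = f} {x} fx = lookup⇒[]= x (tabulate f) (trans (lookup∘tabulate f x) (to T-≡ fx))

∈-tabulate⁻ : {f : Fin m → Bool} {x : Fin m} → x ∈ tabulate f → T (f x)
∈-tabulate⁻ {f = f} {x} x∈ = from T-≡ (trans (sym (lookup∘tabulate f x)) ([]=⇒lookup x∈))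

T-does⇒ : {A : Set} (a? : Dec A) → T (does a?) → A
T-does⇒ a? = toWitness ∘ subst T (sym (isYes≗does a?))

∣tabulate∣-mono : {f g : Fin m → Bool} → (∀ x → T (f x) → T (g x)) →
                  ∣ tabulate f ∣ ≤ ∣ tabulate g ∣
∣tabulate∣-mono {f = f} {g} f⇒g =
  p⊆q⇒∣p∣≤∣q∣ λ x∈ → ∈-tabulate⁺ {f = g} (f⇒g _ (∈-tabulate⁻ {f = f} x∈))

∣tabulate∣≤1 : {f : Fin m → Bool} (u : Fin m) → (∀ x → T (f x) → x ≡ u) → ∣ tabulate f ∣ ≤ 1
∣tabulate∣≤1 {f = f} u f⇒≡u = ≤-trans
  (p⊆q⇒∣p∣≤∣q∣ λ x∈ → subst (_∈ ⁅ u ⁆) (sym (f⇒≡u _ (∈-tabulate⁻ {f = f} x∈))) (x∈⁅x⁆ u))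
  (≤-reflexive (∣⁅x⁆∣≡1 u))

∣p∣≤∣q∣-injectiveOn : (p : Subset m) (q : Subset k) (h : Fin m → Fin k) →
  (∀ {x} → x ∈ p → h x ∈ q) → (∀ {x y} → x ∈ p → y ∈ p → h x ≡ h y → x ≡ y) →
  ∣ p ∣ ≤ ∣ q ∣
∣p∣≤∣q∣-injectiveOn []            q h maps inj = z≤n
∣p∣≤∣q∣-injectiveOn (outside ∷ p) q h maps inj =
  ∣p∣≤∣q∣-injectiveOn p q (h ∘ suc) (maps ∘ there)
    (λ x∈ y∈ → suc-injective ∘ inj (there x∈) (there y∈))
∣p∣≤∣q∣-injectiveOn (inside ∷ p)  q h maps inj = ≤-trans
  (s≤s (∣p∣≤∣q∣-injectiveOn p (q - h zero) (h ∘ suc)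
    (λ x∈ → x∈p∧x≢y⇒x∈p-y (maps (there x∈)) ((λ ()) ∘ inj (there x∈) here))
    (λ x∈ y∈ → suc-injective ∘ inj (there x∈) (there y∈))))
  (x∈p⇒∣p-x∣<∣p∣ (maps here))

remQuot-injective : (i j : Fin (m * k)) → remQuot {m} k i ≡ remQuot {m} k j → i ≡ j
remQuot-injective {m} {k} i j eq = begin
  i                                  ≡⟨ combine-remQuot {m} k i ⟨
  uncurry combine (remQuot {m} k i)  ≡⟨ cong (uncurry combine) eq ⟩
  uncurry combine (remQuot {m} k j)  ≡⟨ combine-remQuot {m} k j ⟩
  j                                  ∎
  where open ≡-Reasoning

combine-≟ : (i j : Fin m) (x y : Fin k) →
  does (combine i x ≟ combine j y) ≡ does (i ≟ j) ∧ does (x ≟ y)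
combine-≟ i j x y = does-⇔
  (mk⇔ (combine-injective i x j y) (λ { (refl , refl) → refl }))
  (combine i x ≟ combine j y) (i ≟ j ×-dec x ≟ y)

≤1⇒zeroOrOdd : ∀ {n} → n ≤ 1 → ZeroOrOdd n
≤1⇒zeroOrOdd = ⊎-map₂ (λ { refl → refl }) ∘ n≤1⇒n≡0∨n≡1

leafNeighbour≡centre : {G : Graph} {S : Fin (n G) → Set} (F : InducesStarForest G S) →
  ∀ {u v} → S u → S v → Adj G v u → v ≢ proj₁ F v → u ≡ proj₁ F v
leafNeighbour≡centre (_ , _ , _ , sameStar) Su Sv vu v≢cv with sameStar _ _ Sv Su vu
... | _       , inj₁ v≡cv = contradiction v≡cv v≢cv
... | cv≡cu   , inj₂ u≡cu = trans u≡cu (sym cv≡cu)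

module StarColouring (G : Graph) {s : ℕ} (φ : Fin (n G) → Fin s) (star : IsStarColouring G φ) where

  N : ℕ
  N = n G

  TwoColoured : Fin s → Fin s → Fin N → Set
  TwoColoured a b w = φ w ≡ a ⊎ φ w ≡ b

  centreOf : Fin s → Fin s → Fin N → Fin N
  centreOf a b = proj₁ (proj₂ star a b)

  hasColourNeighbour : Fin N → Fin s → Fin N → Bool
  hasColourNeighbour v a u = adj G v u ∧ does (φ u ≟ a)

  colourNeighbour⁻ : ∀ {v a u} → T (hasColourNeighbour v a u) → Adj G v u × φ u ≡ a
  colourNeighbour⁻ {v} {a} {u} vau with to T-∧ vau
  ... | vu , φu≡a = to T-≡ vu , T-does⇒ (φ u ≟ a) φu≡a

  Crowded : Fin N → Fin s → Set
  Crowded v a = 2 ≤ nbrColourCount G φ v a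

  leaf⇒uncrowded : ∀ {a b v} → φ v ≡ b → v ≢ centreOf a b v → nbrColourCount G φ v a ≤ 1
  leaf⇒uncrowded {a} {b} {v} φv≡b v≢cv = ∣tabulate∣≤1 {f = hasColourNeighbour v a} _ λ u vau →
    let vu , φu≡a = colourNeighbour⁻ {v} {a} {u} vau
    in leafNeighbour≡centre {G} {TwoColoured a b} (proj₂ star a b) (inj₁ φu≡a) (inj₂ φv≡b) vu v≢cv

  crowded⇒centre : ∀ {u v} → Adj G v u → Crowded v (φ u) → v ≡ centreOf (φ u) (φ v) u
  crowded⇒centre {u} {v} vu crowded with v ≟ centreOf (φ u) (φ v) v
  ... | yes v≡cv = trans v≡cv (proj₁ (sameStar v u (inj₂ refl) (inj₁ refl) vu))
    where sameStar = proj₂ (proj₂ (proj₂ (proj₂ star (φ u) (φ v))))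
  ... | no v≢cv  = contradiction (≤-trans crowded (leaf⇒uncrowded refl v≢cv)) λ { (s≤s ()) }

  crowded? : Fin N → Fin s → Bool
  crowded? v a = does (2 ≤? nbrColourCount G φ v a)

  inCrowdedNbhd : Fin N → Fin s → Fin N → Bool
  inCrowdedNbhd v a u = crowded? v a ∧ hasColourNeighbour v a u

  crowdedNbhd : Fin N → Fin s → Subset N
  crowdedNbhd v a = tabulate (inCrowdedNbhd v a)

  crowdedNbhd⁻ : ∀ {v a u} → T (lookup (crowdedNbhd v a) u) → Crowded v (φ u) × Adj G v u × φ u ≡ a
  crowdedNbhd⁻ {v} {a} {u} u∈ with to (T-∧ {crowded? v a}) (subst T (lookup∘tabulate (inCrowdedNbhd v a) u) u∈)
  ... | crowded , vau with colourNeighbour⁻ {v} {a} {u} vau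
  ...   | vu , refl = T-does⇒ (2 ≤? nbrColourCount G φ v a) crowded , vu , refl

  crowdedNbhd-injective : ∀ {v w a b u} → T (lookup (crowdedNbhd v a) u) →
    T (lookup (crowdedNbhd w b) u) → φ v ≡ φ w → (v , a) ≡ (w , b)
  crowdedNbhd-injective {v} {w} {u = u} u∈v u∈w φv≡φw
    with crowdedNbhd⁻ u∈v | crowdedNbhd⁻ u∈w
  ... | crowdedV , vu , refl | crowdedW , wu , refl = cong (_, φ u) (begin
    v                         ≡⟨ crowded⇒centre vu crowdedV ⟩
    centreOf (φ u) (φ v) u    ≡⟨ cong (λ b → centreOf (φ u) b u) φv≡φw ⟩
    centreOf (φ u) (φ w) u    ≡⟨ crowded⇒centre wu crowdedW ⟨
    w                         ∎)
    where open ≡-Reasoning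

  H : Hypergraph
  H = record { nV = N ; nE = N * s ; edge = uncurry crowdedNbhd ∘ remQuot s }

  edge-combine : ∀ v a u → lookup (edge H (combine v a)) u ≡ inCrowdedNbhd v a u
  edge-combine v a u = trans (cong (λ p → lookup (uncurry crowdedNbhd p) u) (remQuot-combine v a))
                             (lookup∘tabulate (inCrowdedNbhd v a) u)

  -- Distinct edges through u have owners of distinct colours.
  maxDegree : MaxDegreeAtMost H s
  maxDegree u = ≤-trans
    (∣p∣≤∣q∣-injectiveOn _ ⊤ (φ ∘ proj₁ ∘ remQuot s) (λ _ → ∈⊤) λ i∈ j∈ →
      remQuot-injective _ _ ∘ crowdedNbhd-injective (u∈ i∈) (u∈ j∈))
    (≤-reflexive (∣⊤∣≡n s))
    where
    u∈ : ∀ {j} → j ∈ tabulate (λ j → lookup (edge H j) u) → T (lookup (edge H j) u)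
    u∈ = ∈-tabulate⁻

  module _ {c : ℕ} (ψ : Fin N → Fin c) (strongOdd : IsStrongOddHyp H ψ) where

    χ : Fin N → Fin (s * c)
    χ u = combine (φ u) (ψ u)

    χ-proper : IsProper G χ
    χ-proper u v vu = proj₁ star u v vu ∘ combine-injectiveˡ (φ u) (ψ u) (φ v) (ψ v)

    hasProductColourNeighbour : Fin N → Fin s → Fin c → Fin N → Bool
    hasProductColourNeighbour v a i u = hasColourNeighbour v a u ∧ does (ψ u ≟ i)

    nbrColourCount-χ : ∀ v a i →
      nbrColourCount G χ v (combine a i) ≡ ∣ tabulate (hasProductColourNeighbour v a i) ∣
    nbrColourCount-χ v a i = cong ∣_∣ (tabulate-cong λ u → begin
      adj G v u ∧ does (χ u ≟ combine a i)                ≡⟨ cong (adj G v u ∧_) (combine-≟ (φ u) a (ψ u) i) ⟩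
      adj G v u ∧ (does (φ u ≟ a) ∧ does (ψ u ≟ i))       ≡⟨ ∧-assoc (adj G v u) _ _ ⟨
      hasProductColourNeighbour v a i u                   ∎)
      where open ≡-Reasoning

    edgeColourCount-crowded : ∀ {v a} i → crowded? v a ≡ true →
      edgeColourCount H ψ (combine v a) i ≡ ∣ tabulate (hasProductColourNeighbour v a i) ∣
    edgeColourCount-crowded {v} {a} i crowded = cong ∣_∣ (tabulate-cong λ u →
      cong (_∧ does (ψ u ≟ i)) (trans (edge-combine v a u) (cong (_∧ hasColourNeighbour v a u) crowded)))

    productColourCount-zeroOrOdd : ∀ v a i → ZeroOrOdd ∣ tabulate (hasProductColourNeighbour v a i) ∣
    productColourCount-zeroOrOdd v a i with 2 ≤? nbrColourCount G φ v a in crowded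
    ... | yes _        = subst ZeroOrOdd (edgeColourCount-crowded i (cong does crowded))
                                         (strongOdd (combine v a) i)
    ... | no uncrowded = ≤1⇒zeroOrOdd (≤-trans
      (∣tabulate∣-mono {f = hasProductColourNeighbour v a i} {g = hasColourNeighbour v a} λ _ → proj₁ ∘ to T-∧)
      (≤-pred (≰⇒> uncrowded)))

    χ-strongOdd : IsStrongOddColouring G χ
    χ-strongOdd = χ-proper , λ v k →
      let a , i = remQuot {s} c k
      in subst (ZeroOrOdd ∘ nbrColourCount G χ v) (combine-remQuot {s} c k)
           (subst ZeroOrOdd (sym (nbrColourCount-χ v a i)) (productColourCount-zeroOrOdd v a i))

starColourable⇒strongOddColourable : (G : Graph) {s c : ℕ} → StarColourable G s →
  ((H : Hypergraph) → MaxDegreeAtMost H s → Σ (Fin (nV H) → Fin c) (IsStrongOddHyp H)) →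
  StrongOddColourable G (s * c)
starColourable⇒strongOddColourable G (φ , star) colourHypergraph =
  let ψ , strongOdd = colourHypergraph H maxDegree
  in χ ψ strongOdd , χ-strongOdd ψ strongOdd
  where open StarColouring G φ star

proposition21 : ((Δ : ℕ) → Σ ℕ λ c → (H : Hypergraph) → MaxDegreeAtMost H Δ →
    Σ (Fin (nV H) → Fin c) (IsStrongOddHyp H))
    → Σ (ℕ → ℕ) λ g → (G : Graph) (s : ℕ) → IsStarChromaticNumber G s →
    StrongOddColourable G (g s)
proposition21 hypergraphBound = (λ s → s * proj₁ (hypergraphBound s)) , λ G s (starColourable , _) →
  starColourable⇒strongOddColourable G starColourable (proj₂ (hypergraphBound s))
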